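{- Let $D$ be a digraph. The following are equivalent: (i) $\langle D\rangle$ is a left zero semigroup; (ii) $\langle D\rangle$ has a unique $\mathscr{L}$-class; (iii) $D$ has a unique non-trivial connected component $K$, and the digraph $K^{ -1}$, obtained from $K$ by reversing every arc (arcs $(y,x)$ for each arc $(x,y)$ of $K$), is a fan.
   Context: For $a\neq b$ in $\{1,\ldots,n\}$, $(a\to b)$ denotes the transformation mapping $a$ to $b$ and fixing every other point; transformations are composed left to right. For a digraph $D$ on $\{1,\ldots,n\}$ (no loops, no multiple arcs), $\langle D\rangle$ is the semigroup generated by all $(a\to b)$ with $(a,b)$ an arc. Connected components are those of the underlying undirected graph; a component is non-trivial if it has more than one vertex. A left zero semigroup is one in which $ab=a$ for all $a,b$. $\mathscr{L}$ is Green's $\mathscr{L}$-relation. A digraph on $m$ vertices is a fan if it is isomorphic to the digraph on $\{1,\ldots,m\}$ with arcs exactly $(i,m)$, $1\le i\le m-1$. -}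

module Defs where

open import Data.Nat using (ℕ; _<_; _∸_)
open import Data.Fin using (Fin; toℕ; _≟_)
open import Data.Bool using (Bool; true; false; if_then_else_; T)
open import Data.Product using (Σ; ∃; _×_; _,_; proj₁; proj₂)
open import Data.Sum using (_⊎_)
open import Relation.Nullary using (¬_)
open import Relation.Nullary.Decidable using (⌊_⌋)
open import Relation.Binary.PropositionalEquality using (_≡_; _≢_; _≗_)
open import Relation.Binary.Construct.Closure.ReflexiveTransitive using (Star)
open import Function.Bundles using (_⇔_; _↔_; Inverse)

-- A digraph on the vertex set {1,…,n} (encoded as Fin n): a Boolean
-- adjacency relation without loops (no multiple arcs by construction).
record Digraph (n : ℕ) : Set where
  field
    arc      : Fin n → Fin n → Bool
    loopless : ∀ a → arc a a ≡ false

open Digraph public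

Arc : ∀ {n} → Digraph n → Fin n → Fin n → Set
Arc D a b = T (arc D a b)

Transf : ℕ → Set
Transf n = Fin n → Fin n

elem : ∀ {n} → Fin n → Fin n → Transf n
elem a b x = if ⌊ x ≟ a ⌋ then b else x

-- composition left to right: (f ∙ g)(x) = g (f x)
infixl 7 _∙_
_∙_ : ∀ {n} → Transf n → Transf n → Transf n
(f ∙ g) x = g (f x)

-- ⟨ D ⟩ f : f is (syntactically) a product of generators (a → b), (a,b) an arc.
-- Elements of ⟨D⟩ are compared extensionally (pointwise, _≗_).
data ⟨_⟩ {n : ℕ} (D : Digraph n) : Transf n → Set where
  gen : ∀ {a b} → Arc D a b → ⟨ D ⟩ (elem a b)
  mul : ∀ {f g} → ⟨ D ⟩ f → ⟨ D ⟩ g → ⟨ D ⟩ (f ∙ g)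

IsLeftZero : ∀ {n} → Digraph n → Set
IsLeftZero D = ∀ s t → ⟨ D ⟩ s → ⟨ D ⟩ t → (s ∙ t) ≗ s

-- Green's L-relation in S = ⟨D⟩:  s L t  iff  S¹s = S¹t,
-- i.e. s = u t and t = v s for some u, v ∈ S¹.
LeftIdealBelow : ∀ {n} → Digraph n → Transf n → Transf n → Set
LeftIdealBelow D s t = (s ≗ t) ⊎ (∃ λ u → ⟨ D ⟩ u × (s ≗ (u ∙ t)))

GreenL : ∀ {n} → Digraph n → Transf n → Transf n → Set
GreenL D s t = LeftIdealBelow D s t × LeftIdealBelow D t s

HasUniqueLClass : ∀ {n} → Digraph n → Set
HasUniqueLClass D = (∃ λ s → ⟨ D ⟩ s) × (∀ s t → ⟨ D ⟩ s → ⟨ D ⟩ t → GreenL D s t)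

Adj : ∀ {n} → Digraph n → Fin n → Fin n → Set
Adj D a b = Arc D a b ⊎ Arc D b a

Connected : ∀ {n} → Digraph n → Fin n → Fin n → Set
Connected D = Star (Adj D)

IsComponent : ∀ {n} → Digraph n → (Fin n → Bool) → Set
IsComponent D K = ∃ λ c → ∀ v → T (K v) ⇔ Connected D c v

NonTrivial : ∀ {n} → (Fin n → Bool) → Set
NonTrivial K = ∃ λ u → ∃ λ v → T (K u) × T (K v) × u ≢ v

record DigraphOn (V : Set) : Set₁ where
  field
    Arr : V → V → Set

open DigraphOn public

_≅_ : ∀ {V W} → DigraphOn V → DigraphOn W → Set
_≅_ {V} {W} G H = Σ (V ↔ W) λ φ →
  ∀ u v → Arr G u v ⇔ Arr H (Inverse.to φ u) (Inverse.to φ v)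

ReversedComponent : ∀ {n} → Digraph n → (K : Fin n → Bool) →
                    DigraphOn (Σ (Fin n) (λ v → T (K v)))
ReversedComponent D K = record { Arr = λ u v → Arc D (proj₁ v) (proj₁ u) }

-- The fan on m vertices {1,…,m} (here Fin m, vertex m is index m ∸ 1):
-- arcs exactly (i, m) for 1 ≤ i ≤ m - 1
Fan : (m : ℕ) → DigraphOn (Fin m)
Fan m = record { Arr = λ i j → (toℕ i < m ∸ 1) × (toℕ j ≡ m ∸ 1) }

IsFan : ∀ {V} → DigraphOn V → Set
IsFan G = ∃ λ m → G ≅ Fan m

UniqueNonTrivialComponentWithFanReverse : ∀ {n} → Digraph n → Set
UniqueNonTrivialComponentWithFanReverse D =
  ∃ λ K → IsComponent D K × NonTrivial K
        × (∀ K′ → IsComponent D K′ → NonTrivial K′ → ∀ v → T (K v) ⇔ T (K′ v))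
        × IsFan (ReversedComponent D K)

-- A generator (a → b) moves only a, and a is missing from its image.  Hence
-- (a → b) can lie in the left ideal generated by (c → d) only if a = c, so a
-- unique 𝓛-class forces all arcs of D to leave one vertex h.  Conversely, if
-- all arcs leave h then every element of ⟨D⟩ fixes all points other than h
-- and misses h in its image, so s ∙ t = s: ⟨D⟩ is left zero.  Finally "all
-- arcs leave h" says precisely that the closed out-neighbourhood of h is the
-- only non-trivial component and that reversing it gives a fan with hub h.
module Submission where

open import Defs

open import Data.Bool using (Bool; true; false; T; _∨_)
open import Data.Bool.Properties using (T-irrelevant; T-∨)
open import Data.Empty using (⊥-elim)
open import Data.Fin using (Fin; zero; suc; toℕ; fromℕ; _≟_)
open import Data.Fin.Properties
  using (0↔⊥; 1↔⊤; +↔⊎; toℕ-fromℕ; toℕ-injective; ≤fromℕ; sequence)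
open import Data.Fin.Permutation using (transpose)
import Data.Fin.Permutation.Components as PC
open import Data.Nat using (ℕ; zero; suc; _+_; _<_; _≤_)
open import Data.Nat.Properties using (≤∧≢⇒<; <⇒≢)
open import Data.Product using (∃; _×_; Σ; _,_; proj₁; proj₂)
open import Data.Sum using (_⊎_; inj₁; inj₂)
open import Data.Sum.Function.Propositional using (_⊎-↔_)
open import Effect.Monad using (RawMonad)
open import Function using (_∘_)
open import Function.Bundles using (_↔_; Injection; Inverse; mk↔ₛ′; _⇔_; mk⇔; Equivalence)
open import Function.Properties.Inverse using (↔-trans; ↔-sym; ↔⇒↣)
open import Function.Properties.Equivalence using () renaming (trans to ⇔-trans; sym to ⇔-sym)
open import Data.Product.Function.NonDependent.Propositional using (_×-⇔_)
open import Relation.Nullary using (¬_; Dec; yes; no)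
open import Relation.Nullary.Decidable using (⌊_⌋; toWitness; fromWitness; decidable-stable; T?; ¬¬-excluded-middle; dec-true)
open import Relation.Nullary.Negation using (¬¬-Monad)
open import Relation.Binary.PropositionalEquality
open import Relation.Binary.Construct.Closure.ReflexiveTransitive using (ε; _◅_; _◅◅_; reverse)

size : Bool → ℕ
size true  = 1
size false = 0

T↔Fin-size : ∀ b → T b ↔ Fin (size b)
T↔Fin-size true  = ↔-sym 1↔⊤
T↔Fin-size false = ↔-sym 0↔⊥

count : ∀ {n} → (Fin n → Bool) → ℕ
count {zero}  P = 0
count {suc n} P = size (P zero) + count (P ∘ suc)

Σ-Fin-suc↔ : ∀ {n} {P : Fin (suc n) → Set} → Σ (Fin (suc n)) P ↔ (P zero ⊎ Σ (Fin n) (P ∘ suc))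
Σ-Fin-suc↔ {n} {P} = mk↔ₛ′ to from (λ { (inj₁ _) → refl ; (inj₂ _) → refl })
                          (λ { (zero , _) → refl ; (suc _ , _) → refl })
  where
  to : Σ (Fin (suc n)) P → P zero ⊎ Σ (Fin n) (P ∘ suc)
  to (zero , p)  = inj₁ p
  to (suc i , p) = inj₂ (i , p)
  from : P zero ⊎ Σ (Fin n) (P ∘ suc) → Σ (Fin (suc n)) P
  from (inj₁ p)       = zero , p
  from (inj₂ (i , p)) = suc i , p

subset↔Fin-count : ∀ {n} (P : Fin n → Bool) → Σ (Fin n) (T ∘ P) ↔ Fin (count P)
subset↔Fin-count {zero}  P = mk↔ₛ′ (λ { (() , _) }) (λ ()) (λ ()) (λ { (() , _) })
subset↔Fin-count {suc n} P =
  ↔-trans Σ-Fin-suc↔ (↔-trans (T↔Fin-size (P zero) ⊎-↔ subset↔Fin-count (P ∘ suc)) (↔-sym +↔⊎))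

subset-≡ : ∀ {n} {P : Fin n → Bool} {u v : Σ (Fin n) (T ∘ P)} → proj₁ u ≡ proj₁ v → u ≡ v
subset-≡ {u = x , p} {.x , q} refl = cong (x ,_) (T-irrelevant p q)

toℕ≡⇔≡fromℕ : ∀ {k} (i : Fin (suc k)) → toℕ i ≡ k ⇔ i ≡ fromℕ k
toℕ≡⇔≡fromℕ {k} i = mk⇔ (λ e → toℕ-injective (trans e (sym (toℕ-fromℕ k))))
                         (λ { refl → toℕ-fromℕ k })

toℕ<⇔≢fromℕ : ∀ {k} (i : Fin (suc k)) → toℕ i < k ⇔ i ≢ fromℕ k
toℕ<⇔≢fromℕ {k} i =
  mk⇔ (λ lt e → <⇒≢ lt (Equivalence.from (toℕ≡⇔≡fromℕ i) e))
      (λ ne → ≤∧≢⇒< (subst (toℕ i ≤_) (toℕ-fromℕ k) (≤fromℕ i)) (ne ∘ Equivalence.to (toℕ≡⇔≡fromℕ i)))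

transpose-first : ∀ {n} (i j : Fin n) → PC.transpose i j i ≡ j
transpose-first i j rewrite dec-true (i ≟ i) refl = refl

enumeration-ending-with : ∀ {V : Set} {k} → V ↔ Fin (suc k) → (h : V) →
                          Σ (V ↔ Fin (suc k)) λ ψ → Inverse.to ψ h ≡ fromℕ k
enumeration-ending-with {k = k} φ h =
  ↔-trans φ (transpose (Inverse.to φ h) (fromℕ k)) , transpose-first (Inverse.to φ h) (fromℕ k)

IsInStar : ∀ {V} → DigraphOn V → V → Set
IsInStar G h = ∀ u v → Arr G u v ⇔ (u ≢ h × v ≡ h)

-- The hub of Fan (suc k) has index suc k ∸ 1, which reduces to k.
inStar⇒IsFan : ∀ {V m} (G : DigraphOn V) (h : V) → V ↔ Fin m → IsInStar G h → IsFan G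
inStar⇒IsFan {m = zero}  G h φ star with Inverse.to φ h
... | ()
inStar⇒IsFan {m = suc k} G h φ star with enumeration-ending-with φ h
... | ψ , ψh≡last = suc k , ψ , λ u v → ⇔-trans (star u v) (off-hub u ×-⇔ on-hub v)
  where
  hub : ∀ v → v ≡ h ⇔ Inverse.to ψ v ≡ fromℕ k
  hub v = mk⇔ (λ { refl → ψh≡last }) (λ e → Injection.injective (↔⇒↣ ψ) (trans e (sym ψh≡last)))
  on-hub : ∀ v → v ≡ h ⇔ toℕ (Inverse.to ψ v) ≡ k
  on-hub v = ⇔-trans (hub v) (⇔-sym (toℕ≡⇔≡fromℕ _))
  off-hub : ∀ u → u ≢ h ⇔ toℕ (Inverse.to ψ u) < k
  off-hub u = ⇔-trans (mk⇔ (_∘ Equivalence.from (hub u)) (_∘ Equivalence.to (hub u)))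
                      (⇔-sym (toℕ<⇔≢fromℕ _))

fan-arcs-share-head : ∀ {V} {G : DigraphOn V} → IsFan G →
                      ∀ {u v u′ v′} → Arr G u v → Arr G u′ v′ → v ≡ v′
fan-arcs-share-head (m , φ , arcs) uv u′v′ =
  Injection.injective (↔⇒↣ φ)
    (toℕ-injective (trans (proj₂ (Equivalence.to (arcs _ _) uv)) (sym (proj₂ (Equivalence.to (arcs _ _) u′v′)))))

elem-fixes : ∀ {n} (a b : Fin n) {x} → x ≢ a → elem a b x ≡ x
elem-fixes a b {x} x≢a with x ≟ a
... | yes x≡a = ⊥-elim (x≢a x≡a)
... | no _    = refl

elem-image∌source : ∀ {n} {a b : Fin n} → a ≢ b → ∀ x → elem a b x ≢ a
elem-image∌source {a = a} {b} a≢b x with x ≟ a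
... | yes _   = a≢b ∘ sym
... | no x≢a  = x≢a

module _ {n} (D : Digraph n) where

  Arc⇒≢ : ∀ {a b} → Arc D a b → a ≢ b
  Arc⇒≢ {a} ab refl = subst T (loopless D a) ab

  Adj-sym : ∀ {x y} → Adj D x y → Adj D y x
  Adj-sym (inj₁ xy) = inj₂ xy
  Adj-sym (inj₂ yx) = inj₁ yx

  AllArcsFrom : Fin n → Set
  AllArcsFrom h = ∀ {x y} → Arc D x y → x ≡ h

  leftZero⇒uniqueLClass : ∀ {a b} → Arc D a b → IsLeftZero D → HasUniqueLClass D
  leftZero⇒uniqueLClass ab leftZero = (_ , gen ab) , λ s t ⟨s⟩ ⟨t⟩ →
    inj₂ (s , ⟨s⟩ , sym ∘ leftZero s t ⟨s⟩ ⟨t⟩) , inj₂ (t , ⟨t⟩ , sym ∘ leftZero t s ⟨t⟩ ⟨s⟩)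

  below-elem⇒image∌source : ∀ {a b s} → a ≢ b → LeftIdealBelow D s (elem a b) → ∀ x → s x ≢ a
  below-elem⇒image∌source a≢b (inj₁ s≗)           x = subst (_≢ _) (sym (s≗ x)) (elem-image∌source a≢b x)
  below-elem⇒image∌source a≢b (inj₂ (u , _ , s≗)) x = subst (_≢ _) (sym (s≗ x)) (elem-image∌source a≢b (u x))

  -- (c → d) fixes a, so it is not in the left ideal generated by (a → b).
  uniqueLClass⇒allArcsFrom : HasUniqueLClass D → ∀ {a b} → Arc D a b → AllArcsFrom a
  uniqueLClass⇒allArcsFrom (_ , L-related) {a} {b} ab {c} {d} cd with c ≟ a
  ... | yes c≡a = c≡a
  ... | no c≢a  = ⊥-elim (below-elem⇒image∌source (Arc⇒≢ ab) (proj₂ (L-related _ _ (gen ab) (gen cd))) a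
                                                   (elem-fixes c d (c≢a ∘ sym)))

  module _ {h} (from-h : AllArcsFrom h) where

    image∌hub : ∀ {s} → ⟨ D ⟩ s → ∀ x → s x ≢ h
    image∌hub (gen ab)    x with from-h ab
    ... | refl = elem-image∌source (Arc⇒≢ ab) x
    image∌hub (mul {f} _ ⟨g⟩) x = image∌hub ⟨g⟩ (f x)

    fixes-off-hub : ∀ {s} → ⟨ D ⟩ s → ∀ x → x ≢ h → s x ≡ x
    fixes-off-hub (gen {a} {b} ab) x x≢h with from-h ab
    ... | refl = elem-fixes a b x≢h
    fixes-off-hub (mul {f} {g} ⟨f⟩ ⟨g⟩) x x≢h =
      trans (cong g (fixes-off-hub ⟨f⟩ x x≢h)) (fixes-off-hub ⟨g⟩ x x≢h)

    allArcsFrom⇒leftZero : IsLeftZero D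
    allArcsFrom⇒leftZero s t ⟨s⟩ ⟨t⟩ x = fixes-off-hub ⟨t⟩ (s x) (image∌hub ⟨s⟩ x)

  Adj⇒connected-to-source : ∀ {h} → AllArcsFrom h → ∀ {x y} → Adj D x y → Connected D x h
  Adj⇒connected-to-source from-h (inj₁ xy) = subst (Connected D _) (from-h xy) ε
  Adj⇒connected-to-source from-h (inj₂ yx) = subst (Connected D _) (from-h yx) (inj₂ yx ◅ ε)

  module _ {a} (from-a : AllArcsFrom a) where

    outStar : Fin n → Bool
    outStar v = ⌊ v ≟ a ⌋ ∨ arc D a v

    centre∈outStar : T (outStar a)
    centre∈outStar = Equivalence.from (T-∨ {⌊ a ≟ a ⌋}) (inj₁ (fromWitness {a? = a ≟ a} refl))

    arc∈outStar : ∀ {v} → Arc D a v → T (outStar v)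
    arc∈outStar {v} av = Equivalence.from (T-∨ {⌊ v ≟ a ⌋}) (inj₂ av)

    outStar-elim : ∀ {v} → T (outStar v) → v ≡ a ⊎ Arc D a v
    outStar-elim {v} v∈ with Equivalence.to (T-∨ {⌊ v ≟ a ⌋}) v∈
    ... | inj₁ v≡a = inj₁ (toWitness v≡a)
    ... | inj₂ av  = inj₂ av

    adj⇒outStar : ∀ {x y} → Adj D x y → T (outStar y)
    adj⇒outStar (inj₁ xy) = arc∈outStar (subst (λ z → Arc D z _) (from-a xy) xy)
    adj⇒outStar (inj₂ yx) = subst (T ∘ outStar) (sym (from-a yx)) centre∈outStar

    connected⇒outStar : ∀ {x v} → T (outStar x) → Connected D x v → T (outStar v)
    connected⇒outStar x∈ ε       = x∈
    connected⇒outStar _  (s ◅ r) = connected⇒outStar (adj⇒outStar s) r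

    outStar⇒connected : ∀ {v} → T (outStar v) → Connected D a v
    outStar⇒connected v∈ with outStar-elim v∈
    ... | inj₁ refl = ε
    ... | inj₂ av   = inj₁ av ◅ ε

    outStar-isComponent : IsComponent D outStar
    outStar-isComponent = a , λ v → mk⇔ outStar⇒connected (connected⇒outStar centre∈outStar)

    outStar-nonTrivial : ∀ {b} → Arc D a b → NonTrivial outStar
    outStar-nonTrivial ab = _ , _ , centre∈outStar , arc∈outStar ab , Arc⇒≢ ab

    -- Two distinct vertices connected to c cannot both be c, so c lies on an arc.
    nonTrivial⇒reaches-centre : ∀ {K c} → (∀ v → T (K v) ⇔ Connected D c v) → NonTrivial K →
                                Connected D c a
    nonTrivial⇒reaches-centre K≡[c] (u , v , u∈ , v∈ , u≢v) =
      first-step (Equivalence.to (K≡[c] u) u∈) (Equivalence.to (K≡[c] v) v∈) u≢v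
      where
      first-step : ∀ {c x y} → Connected D c x → Connected D c y → x ≢ y → Connected D c a
      first-step ε       ε       x≢y = ⊥-elim (x≢y refl)
      first-step (s ◅ _) _       _   = Adj⇒connected-to-source from-a s
      first-step ε       (s ◅ _) _   = Adj⇒connected-to-source from-a s

    outStar-unique : ∀ K → IsComponent D K → NonTrivial K → ∀ v → T (outStar v) ⇔ T (K v)
    outStar-unique K (c , K≡[c]) K-nonTrivial v =
      mk⇔ (λ v∈ → Equivalence.from (K≡[c] v) (c⇝a ◅◅ outStar⇒connected v∈))
          (λ v∈K → connected⇒outStar centre∈outStar (reverse Adj-sym c⇝a ◅◅ Equivalence.to (K≡[c] v) v∈K))
      where
      c⇝a : Connected D c a
      c⇝a = nonTrivial⇒reaches-centre K≡[c] K-nonTrivial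

    outStar⁻¹-isInStar : IsInStar (ReversedComponent D outStar) (a , centre∈outStar)
    outStar⁻¹-isInStar (u , u∈) (v , v∈) = mk⇔ to from
      where
      to : Arc D v u → (u , u∈) ≢ (a , centre∈outStar) × (v , v∈) ≡ (a , centre∈outStar)
      to vu = (λ u≡a → Arc⇒≢ vu (trans (from-a vu) (sym (cong proj₁ u≡a))))
            , subset-≡ (from-a vu)
      from : (u , u∈) ≢ (a , centre∈outStar) × (v , v∈) ≡ (a , centre∈outStar) → Arc D v u
      from (u≢a , refl) with outStar-elim u∈
      ... | inj₁ u≡a = ⊥-elim (u≢a (subset-≡ u≡a))
      ... | inj₂ au  = au

    allArcsFrom⇒condition-iii : ∀ {b} → Arc D a b → UniqueNonTrivialComponentWithFanReverse D
    allArcsFrom⇒condition-iii ab =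
      outStar , outStar-isComponent , outStar-nonTrivial ab , outStar-unique ,
      inStar⇒IsFan _ _ (subset↔Fin-count outStar) outStar⁻¹-isInStar

  ¬¬-connected-decidable : ∀ x → ¬ ¬ (∀ v → Dec (Connected D x v))
  ¬¬-connected-decidable x = sequence (RawMonad.rawApplicative ¬¬-Monad) (λ _ → ¬¬-excluded-middle)

  decided-class-isComponent : ∀ {x} (connected? : ∀ v → Dec (Connected D x v)) →
                              IsComponent D (λ v → ⌊ connected? v ⌋)
  decided-class-isComponent {x} connected? = x , λ _ → mk⇔ toWitness fromWitness

  -- T (K x) is ¬¬-stable, so while proving it we may assume connectivity from x decided.
  arc-tail∈onlyNonTrivialComponent :
    ∀ (K : Fin n → Bool) → (∀ K′ → IsComponent D K′ → NonTrivial K′ → ∀ v → T (K v) ⇔ T (K′ v)) →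
    ∀ {x y} → Arc D x y → T (K x)
  arc-tail∈onlyNonTrivialComponent K unique {x} {y} xy =
    decidable-stable (T? (K x)) λ x∉K → ¬¬-connected-decidable x λ connected? →
      let x∈[x] = fromWitness {a? = connected? x} ε
          y∈[x] = fromWitness {a? = connected? y} (inj₁ xy ◅ ε)
      in x∉K (Equivalence.from (unique _ (decided-class-isComponent connected?)
                                         (x , y , x∈[x] , y∈[x] , Arc⇒≢ xy) x)
                               x∈[x])

  condition-iii⇒allArcsFrom : UniqueNonTrivialComponentWithFanReverse D → ∀ {a b} → Arc D a b → AllArcsFrom a
  condition-iii⇒allArcsFrom (K , (c , K≡[c]) , _ , unique , fan) {a} {b} ab {x} {y} xy =
    sym (cong proj₁ (fan-arcs-share-head {G = ReversedComponent D K} fan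
                       {b , head∈K ab} {a , tail∈K ab} {y , head∈K xy} {x , tail∈K xy} ab xy))
    where
    tail∈K : ∀ {x y} → Arc D x y → T (K x)
    tail∈K = arc-tail∈onlyNonTrivialComponent K unique
    head∈K : ∀ {x y} → Arc D x y → T (K y)
    head∈K {x} {y} xy = Equivalence.from (K≡[c] y) (Equivalence.to (K≡[c] x) (tail∈K xy) ◅◅ (inj₁ xy ◅ ε))

proposition6p4 : ∀ {n} (D : Digraph n) → (∃ λ a → ∃ λ b → Arc D a b) →
    (IsLeftZero D → HasUniqueLClass D) × (HasUniqueLClass D → UniqueNonTrivialComponentWithFanReverse D)
      × (UniqueNonTrivialComponentWithFanReverse D → IsLeftZero D)
proposition6p4 D (a , b , ab) =
  leftZero⇒uniqueLClass D ab ,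
  (λ uniqueL → allArcsFrom⇒condition-iii D (uniqueLClass⇒allArcsFrom D uniqueL ab) ab) ,
  (λ iii → allArcsFrom⇒leftZero D (condition-iii⇒allArcsFrom D iii ab))
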